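{- Every triangle-free graph with twin-width at most $d$ admits a proper coloring with $d+2$ colors.
   Context: A trigraph has a vertex set, black edges and disjoint red edges; contracting two (not necessarily adjacent) vertices $u,v$ replaces them by a new vertex $z$ with, for each other vertex $x$: $zx$ black if $ux,vx$ both black, red if $x$ is adjacent (black or red) to at least one of $u,v$ but not both via black edges, absent otherwise. A $d$-sequence of an $n$-vertex graph $G$ is a sequence of trigraphs $G=G_n,\ldots,G_1$ whose red graphs have maximum degree at most $d$, with $G_1$ a single vertex and each obtained from the previous by one contraction. The twin-width of $G$ is the minimum $d$ such that $G$ has a $d$-sequence. -}

module Defs where

open import Data.Nat using (ℕ; zero; suc; _≤_; _+_)
open import Data.Fin using (Fin; punchIn; _≟_)
open import Data.Bool using (Bool; true; false; if_then_else_; _∧_)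
open import Data.List using (length; filter)
open import Data.List.Base using () renaming (allFin to allFinL)
open import Data.Product using (Σ; ∃; ∃-syntax; _×_; _,_)
open import Relation.Nullary using (¬_; does)
open import Relation.Binary.PropositionalEquality using (_≡_; _≢_)

record Graph (n : ℕ) : Set where
  field
    adj    : Fin n → Fin n → Bool
    sym    : ∀ x y → adj x y ≡ adj y x
    irrefl : ∀ x → adj x x ≡ false
open Graph public

data EdgeKind : Set where
  none black red : EdgeKind

-- A trigraph on vertex set Fin m: each pair is non-adjacent, black, or red
-- (so black and red edges are disjoint).
Trigraph : ℕ → Set
Trigraph m = Fin m → Fin m → EdgeKind

toTrigraph : ∀ {n} → Graph n → Trigraph n
toTrigraph G x y = if adj G x y then black else none

-- Kind of the edge zx given the kinds of ux and vx (the contraction rule).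
merge : EdgeKind → EdgeKind → EdgeKind
merge black black = black
merge none  none  = none
merge _     _     = red

-- Contracting u and v (u, v distinct) in a trigraph on Fin (suc m).
-- The vertex v is deleted (remaining vertices are relabelled by punchIn v),
-- and the new vertex z takes the place of u.
contract : ∀ {m} → Trigraph (suc m) → Fin (suc m) → Fin (suc m) → Trigraph m
contract {m} T u v x y =
  let x′ = punchIn v x
      y′ = punchIn v y
  in if does (x′ ≟ u) ∧ Data.Bool.not (does (y′ ≟ u)) then merge (T u y′) (T v y′)
     else if does (y′ ≟ u) ∧ Data.Bool.not (does (x′ ≟ u)) then merge (T x′ u) (T x′ v)
     else T x′ y′
  where import Data.Bool

isRed : EdgeKind → Bool
isRed red = true
isRed _   = false

redDegree : ∀ {m} → Trigraph m → Fin m → ℕ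
redDegree {m} T x = length (filter (λ y → isRed (T x y) Data.Bool.≟ true) (allFinL m))
  where import Data.Bool

RedDegreeAtMost : ℕ → ∀ {m} → Trigraph m → Set
RedDegreeAtMost d {m} T = ∀ (x : Fin m) → redDegree T x ≤ d

data DSequence (d : ℕ) : (m : ℕ) → Trigraph m → Set where
  done : (T : Trigraph 1) → RedDegreeAtMost d T → DSequence d 1 T
  step : ∀ {m} (T : Trigraph (suc m)) (u v : Fin (suc m)) → u ≢ v →
         RedDegreeAtMost d T → DSequence d m (contract T u v) →
         DSequence d (suc m) T

-- Twin-width at most d: G has a d-sequence (the twin-width is the minimum
-- such d, so tww(G) ≤ d iff G has a d-sequence).
TwinWidthAtMost : ∀ {n} → Graph n → ℕ → Set
TwinWidthAtMost {n} G d = DSequence d n (toTrigraph G)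

TriangleFree : ∀ {n} → Graph n → Set
TriangleFree {n} G =
  ¬ (∃[ x ] ∃[ y ] ∃[ z ]
       (adj G x y ≡ true × adj G y z ≡ true × adj G x z ≡ true))

ProperColoring : ∀ {n} → Graph n → ℕ → Set
ProperColoring {n} G k =
  Σ (Fin n → Fin k) λ c → ∀ (x y : Fin n) → adj G x y ≡ true → c x ≢ c y

module Submission where

-- Each trigraph of the sequence "realizes" the partition p of V(G) into the
-- parts contracted into its vertices: black edges join complete parts,
-- non-edges anticomplete ones.  Going back from the one-vertex trigraph we
-- colour the parts so that adjacent vertices in independent parts differ.
-- To undo the contraction of u, v into z we keep the colouring if z is
-- independent.  Otherwise z spans an edge x₁y₁, so by triangle-freeness no
-- part is black-adjacent to z and every other part containing a neighbour
-- of u ∪ v is one of the at most d red neighbours of z; two colours outside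
-- theirs remain for u and v.  In G every part is an independent singleton.

open import Defs hiding (sym)
open import Data.Nat using (ℕ; suc; _+_; _≤_; _<_; z≤n; s≤s)
open import Data.Nat.Properties using (<⇒≱; ≤-<-trans; m<m+n; +-comm)
open import Data.Fin using (Fin; zero; punchIn; punchOut; _≟_; _↑ʳ_)
open import Data.Fin.Properties
  using (¬∀⟶∃¬; injective⇒≤; any?; punchIn-injective; punchIn-punchOut)
open import Data.Bool using (true; false)
import Data.Bool as Bool
open import Data.List using (List; _∷_; length; filter; map; lookup)
open import Data.List.Base using () renaming (allFin to allFinL)
open import Data.List.Properties using (length-map)
open import Data.List.Membership.Propositional using (_∈_; _∉_)
open import Data.List.Membership.Propositional.Properties
  using (∈-filter⁺; ∈-allFin; ∈-map⁺)
open import Data.List.Relation.Unary.Any using (here; there; index)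
import Data.List.Relation.Unary.Any as Any
open import Data.List.Relation.Unary.Any.Properties using (lookup-index)
open import Data.Product using (∃; ∃₂; _×_; _,_; proj₁; proj₂)
open import Data.Sum using (_⊎_; inj₁; inj₂)
open import Data.Empty using (⊥-elim)
open import Function using (_∘_; id)
open import Function.Definitions using (Injective)
open import Relation.Nullary using (¬_; yes; no)
open import Relation.Nullary.Decidable using (_×-dec_)
open import Relation.Binary.PropositionalEquality
  using (_≡_; _≢_; refl; sym; trans; cong; cong₂; subst; module ≡-Reasoning)

-- A list of fewer than k elements of Fin k misses one of them: otherwise
-- sending each element to a position where it occurs would inject Fin k
-- into the positions of the list.
missing : ∀ {k} (L : List (Fin k)) → length L < k → ∃ λ i → i ∉ L
missing {k} L |L|<k = ¬∀⟶∃¬ k (_∈ L) (λ i → Any.any? (i ≟_) L) not-all-listed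
  where
  not-all-listed : ¬ (∀ i → i ∈ L)
  not-all-listed listed = <⇒≱ |L|<k (injective⇒≤ position-injective)
    where
    open ≡-Reasoning
    position-injective : Injective _≡_ _≡_ (λ i → index (listed i))
    position-injective {i} {j} same-position = begin
      i                            ≡⟨ lookup-index (listed i) ⟩
      lookup L (index (listed i))  ≡⟨ cong (lookup L) same-position ⟩
      lookup L (index (listed j))  ≡⟨ sym (lookup-index (listed j)) ⟩
      j                            ∎

two-free-colours : ∀ d (S : List (Fin (d + 2))) → length S ≤ d →
  ∃₂ λ α β → α ≢ β × α ∉ S × β ∉ S
two-free-colours d S |S|≤d with missing S (≤-<-trans |S|≤d (m<m+n d (s≤s z≤n)))
... | α , α∉S with missing (α ∷ S) (subst (suc (length S) <_) (+-comm 2 d) (s≤s (s≤s |S|≤d)))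
... | β , β∉α∷S = α , β , (λ α≡β → β∉α∷S (here (sym α≡β))) , α∉S , (β∉α∷S ∘ there)

merge-agree : ∀ {e f k} → k ≢ red → merge e f ≡ k → e ≡ k × f ≡ k
merge-agree {none}  {none}  _     same = same , same
merge-agree {black} {black} _     same = same , same
merge-agree {none}  {black} k≢red refl = ⊥-elim (k≢red refl)
merge-agree {none}  {red}   k≢red refl = ⊥-elim (k≢red refl)
merge-agree {black} {none}  k≢red refl = ⊥-elim (k≢red refl)
merge-agree {black} {red}   k≢red refl = ⊥-elim (k≢red refl)
merge-agree {red}           k≢red refl = ⊥-elim (k≢red refl)

redNeighbours : ∀ {m} → Trigraph m → Fin m → List (Fin m)
redNeighbours {m} T x = filter (λ y → isRed (T x y) Bool.≟ true) (allFinL m)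

red-neighbour : ∀ {m} (T : Trigraph m) {x y} → T x y ≡ red → y ∈ redNeighbours T x
red-neighbour T {x} {y} xy-red =
  ∈-filter⁺ (λ z → isRed (T x z) Bool.≟ true) (∈-allFin y) (cong isRed xy-red)

initial-red-degree : ∀ {d m T} → DSequence d m T → RedDegreeAtMost d T
initial-red-degree (done _ bounded)         = bounded
initial-red-degree (step _ _ _ _ bounded _) = bounded

-- Contracting u and v in T.  A vertex a of T becomes the vertex `squash a`
-- of the contracted trigraph: v is sent to the new vertex z = squash u and
-- the other vertices keep their identity.
module Contraction {m} (T : Trigraph (suc m)) {u v : Fin (suc m)} (u≢v : u ≢ v) where

  squash : Fin (suc m) → Fin m
  squash a with a ≟ v
  ... | yes _   = punchOut (u≢v ∘ sym)
  ... | no a≢v  = punchOut (a≢v ∘ sym)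

  -- `contract` names the vertices of T by punchIn v; these two facts say
  -- that punchIn v undoes squash, up to identifying v with u.
  unsquash-off-v : ∀ {a} → a ≢ v → punchIn v (squash a) ≡ a
  unsquash-off-v {a} a≢v with a ≟ v
  ... | yes a≡v = ⊥-elim (a≢v a≡v)
  ... | no _    = punchIn-punchOut _

  unsquash-v : punchIn v (squash v) ≡ u
  unsquash-v with v ≟ v
  ... | yes _   = punchIn-punchOut _
  ... | no v≢v  = ⊥-elim (v≢v refl)

  Merged : Fin (suc m) → Set
  Merged a = a ≡ u ⊎ a ≡ v

  data Position (a : Fin (suc m)) : Set where
    merged    : Merged a → Position a
    elsewhere : a ≢ u → a ≢ v → Position a

  position : ∀ a → Position a
  position a with a ≟ u | a ≟ v
  ... | yes a≡u | _       = merged (inj₁ a≡u)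
  ... | no _    | yes a≡v = merged (inj₂ a≡v)
  ... | no a≢u  | no a≢v  = elsewhere a≢u a≢v

  merged-distinct : ∀ {a b} → Merged a → b ≢ u → b ≢ v → a ≢ b
  merged-distinct (inj₁ refl) b≢u _ = b≢u ∘ sym
  merged-distinct (inj₂ refl) _ b≢v = b≢v ∘ sym

  unsquash-merged : ∀ {a} → Merged a → punchIn v (squash a) ≡ u
  unsquash-merged (inj₁ refl) = unsquash-off-v u≢v
  unsquash-merged (inj₂ refl) = unsquash-v

  unsquash-elsewhere : ∀ {a} → a ≢ u → a ≢ v → punchIn v (squash a) ≢ u
  unsquash-elsewhere a≢u a≢v lands-on-u = a≢u (trans (sym (unsquash-off-v a≢v)) lands-on-u)

  squash-merged : ∀ {a} → Merged a → squash a ≡ squash u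
  squash-merged a-merged =
    punchIn-injective v _ _ (trans (unsquash-merged a-merged) (sym (unsquash-merged (inj₁ refl))))

  squash-injective-off-v : ∀ {a b} → a ≢ v → b ≢ v → squash a ≡ squash b → a ≡ b
  squash-injective-off-v {a} {b} a≢v b≢v same = begin
    a                      ≡⟨ sym (unsquash-off-v a≢v) ⟩
    punchIn v (squash a)   ≡⟨ cong (punchIn v) same ⟩
    punchIn v (squash b)   ≡⟨ unsquash-off-v b≢v ⟩
    b                      ∎
    where open ≡-Reasoning

  squash-elsewhere : ∀ {a b} → a ≢ u → a ≢ v → squash b ≡ squash a → b ≡ a
  squash-elsewhere {a} {b} a≢u a≢v same with position b
  ... | merged b-merged = ⊥-elim (a≢u (sym (squash-injective-off-v u≢v a≢v
                            (trans (sym (squash-merged b-merged)) same))))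
  ... | elsewhere _ b≢v = squash-injective-off-v b≢v a≢v same

  squash-fibre : ∀ {a} → squash a ≡ squash u → Merged a
  squash-fibre {a} same with position a
  ... | merged a-merged     = a-merged
  ... | elsewhere a≢u a≢v   = ⊥-elim (a≢u (sym (squash-elsewhere a≢u a≢v (sym same))))

  module _ {x y : Fin m} where
    contract-row : punchIn v x ≡ u → punchIn v y ≢ u →
      contract T u v x y ≡ merge (T u (punchIn v y)) (T v (punchIn v y))
    contract-row x-is-z y-not-z with punchIn v x ≟ u | punchIn v y ≟ u
    ... | yes _   | yes y-is-z = ⊥-elim (y-not-z y-is-z)
    ... | yes _   | no _       = refl
    ... | no x-not-z | _       = ⊥-elim (x-not-z x-is-z)

    contract-column : punchIn v x ≢ u → punchIn v y ≡ u →
      contract T u v x y ≡ merge (T (punchIn v x) u) (T (punchIn v x) v)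
    contract-column x-not-z y-is-z with punchIn v x ≟ u | punchIn v y ≟ u
    ... | yes x-is-z | _          = ⊥-elim (x-not-z x-is-z)
    ... | no _       | yes _      = refl
    ... | no _       | no y-not-z = ⊥-elim (y-not-z y-is-z)

    contract-rest : punchIn v x ≢ u → punchIn v y ≢ u →
      contract T u v x y ≡ T (punchIn v x) (punchIn v y)
    contract-rest x-not-z y-not-z with punchIn v x ≟ u | punchIn v y ≟ u
    ... | yes x-is-z | _          = ⊥-elim (x-not-z x-is-z)
    ... | no _       | yes y-is-z = ⊥-elim (y-not-z y-is-z)
    ... | no _       | no _       = refl

  contract-merged-row : ∀ {a b} → Merged a → b ≢ u → b ≢ v →
    contract T u v (squash a) (squash b) ≡ merge (T u b) (T v b)
  contract-merged-row a-merged b≢u b≢v =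
    trans (contract-row (unsquash-merged a-merged) (unsquash-elsewhere b≢u b≢v))
          (cong (λ y → merge (T u y) (T v y)) (unsquash-off-v b≢v))

  contract-merged-column : ∀ {a b} → a ≢ u → a ≢ v → Merged b →
    contract T u v (squash a) (squash b) ≡ merge (T a u) (T a v)
  contract-merged-column a≢u a≢v b-merged =
    trans (contract-column (unsquash-elsewhere a≢u a≢v) (unsquash-merged b-merged))
          (cong (λ x → merge (T x u) (T x v)) (unsquash-off-v a≢v))

  contract-elsewhere : ∀ {a b} → a ≢ u → a ≢ v → b ≢ u → b ≢ v →
    contract T u v (squash a) (squash b) ≡ T a b
  contract-elsewhere a≢u a≢v b≢u b≢v =
    trans (contract-rest (unsquash-elsewhere a≢u a≢v) (unsquash-elsewhere b≢u b≢v))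
          (cong₂ T (unsquash-off-v a≢v) (unsquash-off-v b≢v))

  from-merged : ∀ {a b k} → Merged a → T u b ≡ k × T v b ≡ k → T a b ≡ k
  from-merged (inj₁ refl) both = proj₁ both
  from-merged (inj₂ refl) both = proj₂ both

  into-merged : ∀ {a b k} → Merged b → T a u ≡ k × T a v ≡ k → T a b ≡ k
  into-merged (inj₁ refl) both = proj₁ both
  into-merged (inj₂ refl) both = proj₂ both

  -- Contraction only creates red edges: every black edge and every
  -- non-edge of the contracted trigraph is inherited from T.
  contract-inherits : ∀ a b {k} → squash a ≢ squash b → k ≢ red →
    contract T u v (squash a) (squash b) ≡ k → T a b ≡ k
  contract-inherits a b {k} distinct k≢red is-k with position a | position b
  ... | merged a-merged | merged b-merged =
    ⊥-elim (distinct (trans (squash-merged a-merged) (sym (squash-merged b-merged))))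
  ... | merged a-merged | elsewhere b≢u b≢v =
    from-merged a-merged
      (merge-agree k≢red (trans (sym (contract-merged-row a-merged b≢u b≢v)) is-k))
  ... | elsewhere a≢u a≢v | merged b-merged =
    into-merged b-merged
      (merge-agree k≢red (trans (sym (contract-merged-column a≢u a≢v b-merged)) is-k))
  ... | elsewhere a≢u a≢v | elsewhere b≢u b≢v =
    trans (sym (contract-elsewhere a≢u a≢v b≢u b≢v)) is-k

module Colouring {n} (G : Graph n) where

  Independent : ∀ {m} → (Fin n → Fin m) → Fin m → Set
  Independent p b = ∀ x y → p x ≡ b → p y ≡ b → adj G x y ≡ false

  independent? : ∀ {m} (p : Fin n → Fin m) b →
    Independent p b ⊎ ∃₂ λ x y → p x ≡ b × p y ≡ b × adj G x y ≡ true
  independent? p b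
    with any? (λ x → any? (λ y → (p x ≟ b) ×-dec (p y ≟ b) ×-dec (adj G x y Bool.≟ true)))
  ... | yes (x , y , edge-in-b) = inj₂ (x , y , edge-in-b)
  ... | no no-edge-in-b         = inj₁ independent
    where
    independent : Independent p b
    independent x y px≡b py≡b with adj G x y in xy
    ... | true  = ⊥-elim (no-edge-in-b (x , y , px≡b , py≡b , xy))
    ... | false = refl

  Realizes : ∀ {m} → Trigraph m → (Fin n → Fin m) → Set
  Realizes T p = ∀ x y → p x ≢ p y →
    (T (p x) (p y) ≡ black → adj G x y ≡ true) × (T (p x) (p y) ≡ none → adj G x y ≡ false)

  -- The invariant of the induction: a colouring of the parts that
  -- separates adjacent vertices whenever both their parts are independent.
  ProperOnIndependentParts : ∀ {m k} → (Fin n → Fin m) → (Fin m → Fin k) → Set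
  ProperOnIndependentParts p c = ∀ x y → adj G x y ≡ true →
    Independent p (p x) → Independent p (p y) → c (p x) ≢ c (p y)

  adjacent-sym : ∀ {x y} → adj G x y ≡ true → adj G y x ≡ true
  adjacent-sym {x} {y} xy = trans (Graph.sym G y x) xy

  inside-independent : ∀ {m} {p : Fin n → Fin m} {x y} →
    Independent p (p x) → p y ≡ p x → adj G x y ≢ true
  inside-independent independent-x same xy with () ← trans (sym (independent-x _ _ refl same)) xy

  one-part : ∀ {k} (p : Fin n → Fin 1) (c : Fin 1 → Fin k) → ProperOnIndependentParts p c
  one-part p c x y xy independent-x _ _ =
    inside-independent independent-x (only-part (p y) (p x)) xy
    where
    only-part : (a b : Fin 1) → a ≡ b
    only-part zero zero = refl

  module Uncontract {m} (T : Trigraph (suc m)) {u v : Fin (suc m)} (u≢v : u ≢ v)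
                    (p : Fin n → Fin (suc m)) (realizes : Realizes T p) where
    open Contraction T u≢v

    p′ : Fin n → Fin m
    p′ = squash ∘ p

    -- Contraction only creates red edges, so the quotient stays faithful.
    realizes′ : Realizes (contract T u v) p′
    realizes′ x y distinct =
      (λ black′ → proj₁ (realizes x y (distinct ∘ cong squash)) (inherits black′ (λ ()))) ,
      (λ none′  → proj₂ (realizes x y (distinct ∘ cong squash)) (inherits none′ (λ ())))
      where
      inherits : ∀ {k} → contract T u v (p′ x) (p′ y) ≡ k → k ≢ red → T (p x) (p y) ≡ k
      inherits is-k k≢red = contract-inherits (p x) (p y) distinct k≢red is-k

    independent-elsewhere : ∀ {a} → a ≢ u → a ≢ v → Independent p a → Independent p′ (squash a)
    independent-elsewhere a≢u a≢v independent x y in-a in-a′ =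
      independent x y (squash-elsewhere a≢u a≢v in-a) (squash-elsewhere a≢u a≢v in-a′)

    keep-colouring : ∀ {k} {c′ : Fin m → Fin k} → Independent p′ (squash u) →
      ProperOnIndependentParts p′ c′ → ProperOnIndependentParts p (c′ ∘ squash)
    keep-colouring {c′ = c′} independent-z proper′ x y xy independent-x independent-y =
      proper′ x y xy (independent′ independent-x) (independent′ independent-y)
      where
      independent′ : ∀ {a} → Independent p a → Independent p′ (squash a)
      independent′ {a} independent-a with position a
      ... | merged a-merged     = subst (Independent p′) (sym (squash-merged a-merged)) independent-z
      ... | elsewhere a≢u a≢v   = independent-elsewhere a≢u a≢v independent-a

    -- When the new part z spans an edge x₁y₁ of a triangle-free graph, every
    -- part outside z containing a neighbour of u ∪ v is a red neighbour of z:
    -- a non-edge would contradict the adjacency, a black edge would close a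
    -- triangle with x₁y₁.
    module _ (triangle-free : TriangleFree G) {x₁ y₁ : Fin n}
             (x₁-in-z : p′ x₁ ≡ squash u) (y₁-in-z : p′ y₁ ≡ squash u)
             (x₁y₁ : adj G x₁ y₁ ≡ true) where

      neighbour-part-red : ∀ x y → adj G x y ≡ true → Merged (p x) → p y ≢ u → p y ≢ v →
        contract T u v (squash u) (squash (p y)) ≡ red
      neighbour-part-red x y xy x-merged y≢u y≢v with merge (T u (p y)) (T v (p y)) in merged-edge
      ... | red   = trans (contract-merged-row (inj₁ refl) y≢u y≢v) merged-edge
      ... | none  with () ← trans (sym (proj₂ (realizes x y (merged-distinct x-merged y≢u y≢v))
                              (from-merged x-merged (merge-agree (λ ()) merged-edge)))) xy
      ... | black =
        ⊥-elim (triangle-free (x₁ , y₁ , y , x₁y₁ , adjacent-to-y y₁-in-z , adjacent-to-y x₁-in-z))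
        where
        adjacent-to-y : ∀ {w} → p′ w ≡ squash u → adj G w y ≡ true
        adjacent-to-y {w} w-in-z = proj₁ (realizes w y (merged-distinct w-merged y≢u y≢v))
                                 (from-merged w-merged (merge-agree (λ ()) merged-edge))
          where
          w-merged : Merged (p w)
          w-merged = squash-fibre w-in-z

      module Recolour {k} (c′ : Fin m → Fin k) (proper′ : ProperOnIndependentParts p′ c′)
                      {α β : Fin k} (α≢β : α ≢ β)
                      (avoids-red : ∀ {b} → contract T u v (squash u) b ≡ red → c′ b ≢ α × c′ b ≢ β)
                      where

        recoloured : Fin (suc m) → Fin k
        recoloured a with position a
        ... | merged (inj₁ _)  = α
        ... | merged (inj₂ _)  = β
        ... | elsewhere _ _    = c′ (squash a)

        neighbour-avoids : ∀ x y → adj G x y ≡ true → Merged (p x) → p y ≢ u → p y ≢ v →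
          c′ (squash (p y)) ≢ α × c′ (squash (p y)) ≢ β
        neighbour-avoids x y xy x-merged y≢u y≢v =
          avoids-red (neighbour-part-red x y xy x-merged y≢u y≢v)

        recoloured-proper : ProperOnIndependentParts p recoloured
        recoloured-proper x y xy independent-x independent-y with position (p x) | position (p y)
        ... | merged (inj₁ x-u) | merged (inj₁ y-u) =
          λ _ → inside-independent independent-x (trans y-u (sym x-u)) xy
        ... | merged (inj₁ _)   | merged (inj₂ _)   = α≢β
        ... | merged (inj₂ _)   | merged (inj₁ _)   = α≢β ∘ sym
        ... | merged (inj₂ x-v) | merged (inj₂ y-v) =
          λ _ → inside-independent independent-x (trans y-v (sym x-v)) xy
        ... | merged (inj₁ x-u) | elsewhere y≢u y≢v =
          proj₁ (neighbour-avoids x y xy (inj₁ x-u) y≢u y≢v) ∘ sym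
        ... | merged (inj₂ x-v) | elsewhere y≢u y≢v =
          proj₂ (neighbour-avoids x y xy (inj₂ x-v) y≢u y≢v) ∘ sym
        ... | elsewhere x≢u x≢v | merged (inj₁ y-u) =
          proj₁ (neighbour-avoids y x (adjacent-sym xy) (inj₁ y-u) x≢u x≢v)
        ... | elsewhere x≢u x≢v | merged (inj₂ y-v) =
          proj₂ (neighbour-avoids y x (adjacent-sym xy) (inj₂ y-v) x≢u x≢v)
        ... | elsewhere x≢u x≢v | elsewhere y≢u y≢v =
          proper′ x y xy (independent-elsewhere x≢u x≢v independent-x)
                         (independent-elsewhere y≢u y≢v independent-y)

    red-colours : ∀ {k} → (Fin m → Fin k) → List (Fin k)
    red-colours c′ = map c′ (redNeighbours (contract T u v) (squash u))

    few-red-colours : ∀ {d k} → RedDegreeAtMost d (contract T u v) →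
      (c′ : Fin m → Fin k) → length (red-colours c′) ≤ d
    few-red-colours {d} red-degree c′ =
      subst (_≤ d) (sym (length-map c′ (redNeighbours (contract T u v) (squash u))))
            (red-degree (squash u))

    uncontract-colouring : ∀ {d} → TriangleFree G → RedDegreeAtMost d (contract T u v) →
      (c′ : Fin m → Fin (d + 2)) → ProperOnIndependentParts p′ c′ →
      ∃ λ (c : Fin (suc m) → Fin (d + 2)) → ProperOnIndependentParts p c
    uncontract-colouring {d} triangle-free red-degree c′ proper′ with independent? p′ (squash u)
    ... | inj₁ independent-z = c′ ∘ squash , keep-colouring {c′ = c′} independent-z proper′
    ... | inj₂ (x₁ , y₁ , x₁-in-z , y₁-in-z , x₁y₁)
      with two-free-colours d (red-colours c′) (few-red-colours red-degree c′)
    ...   | α , β , α≢β , α∉red-colours , β∉red-colours = R.recoloured , R.recoloured-proper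
      where
      avoids-red : ∀ {b} → contract T u v (squash u) b ≡ red → c′ b ≢ α × c′ b ≢ β
      avoids-red {b} b-red = (λ is-α → α∉red-colours (subst (_∈ red-colours c′) is-α listed))
                       , (λ is-β → β∉red-colours (subst (_∈ red-colours c′) is-β listed))
        where
        listed : c′ b ∈ red-colours c′
        listed = ∈-map⁺ c′ (red-neighbour (contract T u v) b-red)

      module R = Recolour triangle-free x₁-in-z y₁-in-z x₁y₁ c′ proper′ α≢β avoids-red

  colour-parts : ∀ {d m} {T : Trigraph m} → TriangleFree G → DSequence d m T →
    (p : Fin n → Fin m) → Realizes T p →
    ∃ λ (c : Fin m → Fin (d + 2)) → ProperOnIndependentParts p c
  colour-parts {d} triangle-free (done _ _) p _ = (λ _ → d ↑ʳ zero) , one-part p (λ _ → d ↑ʳ zero)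
  colour-parts triangle-free (step T u v u≢v _ rest) p realizes =
    let c′ , proper′ = colour-parts triangle-free rest p′ realizes′
    in uncontract-colouring triangle-free (initial-red-degree rest) c′ proper′
    where open Uncontract T u≢v p realizes

  graph-realizes : Realizes (toTrigraph G) id
  graph-realizes x y _ with adj G x y
  ... | true  = (λ _ → refl) , (λ ())
  ... | false = (λ ()) , (λ _ → refl)

  singleton-independent : ∀ x → Independent id x
  singleton-independent x _ _ refl refl = irrefl G x

theorem17 : ∀ (n d : ℕ) (G : Graph n) → TriangleFree G → TwinWidthAtMost G d →
    ProperColoring G (d + 2)
theorem17 n d G triangle-free sequence =
  let c , proper = colour-parts triangle-free sequence id graph-realizes
  in c , λ x y xy → proper x y xy (singleton-independent x) (singleton-independent y)
  where open Colouring G
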